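{- Let $\mathcal{A}$ be a kit on a groupoid $\mathbb{A}$. Then $\mathcal{A}=\mathcal{A}^{\perp\perp}$ if and only if (1) for all $a\in\mathbb{A}$, $\mathcal{A}(a)=\{H\le\mathrm{End}(a): H\subseteq\bigcup\mathcal{A}(a)\}$, and (2) $\mathcal{A}$ is saturated.
   Context: A kit on a groupoid $\mathbb{A}$ is a family $\mathcal{A}=\{\mathcal{A}(a)\}_{a\in\mathbb{A}}$ with $\mathcal{A}(a)$ a set of subgroups of $\mathrm{End}(a)=\mathbb{A}(a,a)$, closed under conjugation. Subgroups $H,K$ of $\mathrm{End}(a)$ (the endomorphism group of $a$ in $\mathbb{A}^{op}$ having the same underlying set) are orthogonal if $H\cap K=\{\mathrm{id}_a\}$; $\mathcal{A}^\perp$ is the kit on $\mathbb{A}^{op}$ with $\mathcal{A}^\perp(a)$ the set of subgroups orthogonal to every member of $\mathcal{A}(a)$, and $\mathcal{A}^{\perp\perp}=(\mathcal{A}^\perp)^\perp$. $\bigcup\mathcal{A}(a)$ is the union of the members of $\mathcal{A}(a)$. The kit $\mathcal{A}$ is saturated if for every $a$ and $\alpha\in\mathrm{End}(a)$: whenever for all $n\in\mathbb{N}$ either $\alpha^n=\mathrm{id}$ or there exists $m\in\mathbb{N}$ with $\alpha^{nm}\neq\mathrm{id}$ and $\alpha^{nm}\in\bigcup\mathcal{A}(a)$, then $\alpha\in\bigcup\mathcal{A}(a)$. -}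

module Defs where

open import Level using (Level; _⊔_; suc)
open import Data.Nat using (ℕ; zero; _*_)
import Data.Nat as ℕ
open import Data.Product using (Σ; _×_; ∃; ∃-syntax)
open import Data.Sum using (_⊎_)
open import Relation.Nullary using (¬_)
open import Relation.Unary using (Pred; _∈_)
open import Relation.Binary.PropositionalEquality using (_≡_)
open import Function.Bundles using (_⇔_)

record Groupoid (o ℓ : Level) : Set (suc (o ⊔ ℓ)) where
  infixr 9 _∘_
  field
    Obj  : Set o
    Hom  : Obj → Obj → Set ℓ
    id   : ∀ {a} → Hom a a
    _∘_  : ∀ {a b c} → Hom b c → Hom a b → Hom a c
    _⁻¹  : ∀ {a b} → Hom a b → Hom b a
    assoc     : ∀ {a b c d} (h : Hom c d) (g : Hom b c) (f : Hom a b) →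
                (h ∘ g) ∘ f ≡ h ∘ (g ∘ f)
    identityˡ : ∀ {a b} (f : Hom a b) → id ∘ f ≡ f
    identityʳ : ∀ {a b} (f : Hom a b) → f ∘ id ≡ f
    inverseˡ  : ∀ {a b} (f : Hom a b) → (f ⁻¹) ∘ f ≡ id
    inverseʳ  : ∀ {a b} (f : Hom a b) → f ∘ (f ⁻¹) ≡ id

op : ∀ {o ℓ} → Groupoid o ℓ → Groupoid o ℓ
op G = record
  { Obj = Obj
  ; Hom = λ a b → Hom b a
  ; id = id
  ; _∘_ = λ f g → g ∘ f
  ; _⁻¹ = _⁻¹
  ; assoc = λ h g f → Eq.sym (assoc f g h)
  ; identityˡ = identityʳ
  ; identityʳ = identityˡ
  ; inverseˡ = inverseʳ
  ; inverseʳ = inverseˡ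
  }
  where
  open Groupoid G
  import Relation.Binary.PropositionalEquality as Eq

record SubgroupOf {ℓ : Level} {X : Set ℓ} (e : X) (_·_ : X → X → X) (inv : X → X)
                  : Set (suc ℓ) where
  field
    carrier : Pred X ℓ
    has-e   : e ∈ carrier
    has-·   : ∀ {x y} → x ∈ carrier → y ∈ carrier → (x · y) ∈ carrier
    has-inv : ∀ {x} → x ∈ carrier → inv x ∈ carrier

module _ {o ℓ : Level} (G : Groupoid o ℓ) where
  open Groupoid G

  Subgroup : Obj → Set (suc ℓ)
  Subgroup a = SubgroupOf (id {a}) _∘_ _⁻¹

  _∈ₛ_ : ∀ {a} → Hom a a → Subgroup a → Set ℓ
  g ∈ₛ H = g ∈ SubgroupOf.carrier H

  KitFamily : (q : Level) → Set (o ⊔ suc ℓ ⊔ suc q)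
  KitFamily q = (a : Obj) → Pred (Subgroup a) q

  -- Closure under conjugation: if H ∈ A(a) and f : a → b, then
  -- f H f⁻¹ (= any subgroup K of End(b) with g ∈ K ⇔ f⁻¹ g f ∈ H) is in A(b).
  ConjugationClosed : ∀ {q} → KitFamily q → Set (o ⊔ suc ℓ ⊔ q)
  ConjugationClosed A =
    ∀ {a b} (f : Hom a b) (H : Subgroup a) (K : Subgroup b) →
    (∀ g → g ∈ₛ K ⇔ ((f ⁻¹) ∘ (g ∘ f)) ∈ₛ H) →
    H ∈ A a → K ∈ A b

  record Kit (q : Level) : Set (o ⊔ suc ℓ ⊔ suc q) where
    field
      family    : KitFamily q
      conj-closed : ConjugationClosed family

  Orthogonal : ∀ {a} → Subgroup a → Subgroup a → Set ℓ
  Orthogonal {a} H K = ∀ (g : Hom a a) → g ∈ₛ H → g ∈ₛ K → g ≡ id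

  ⋃ : ∀ {q} → KitFamily q → (a : Obj) → Pred (Hom a a) (suc ℓ ⊔ q)
  ⋃ A a α = ∃[ H ] (H ∈ A a × α ∈ₛ H)

  pow : ∀ {a} → Hom a a → ℕ → Hom a a
  pow α zero = id
  pow α (ℕ.suc n) = α ∘ pow α n

  Saturated : ∀ {q} → KitFamily q → Set (o ⊔ suc ℓ ⊔ q)
  Saturated A = ∀ (a : Obj) (α : Hom a a) →
    (∀ (n : ℕ) → pow α n ≡ id ⊎
       (∃[ m ] (¬ (pow α (n * m) ≡ id) × pow α (n * m) ∈ ⋃ A a))) →
    α ∈ ⋃ A a

  Condition1 : ∀ {q} → KitFamily q → Set (o ⊔ suc ℓ ⊔ q)
  Condition1 A = ∀ (a : Obj) (H : Subgroup a) →
    H ∈ A a ⇔ (∀ (g : Hom a a) → g ∈ₛ H → g ∈ ⋃ A a)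

-- A^⊥ : the (family of the) kit on G^op with A^⊥(a) the subgroups of
-- End_{G^op}(a) orthogonal to every member of A(a).
-- (A subgroup of End(a) and of End_{G^op}(a) is the same kind of subset; the
-- type Subgroup (op G) a is the same up to the reversed multiplication.)
-- A subgroup of End(a) viewed as a subgroup of End_{G^op}(a) (same subset).
toOp : ∀ {o ℓ} (G : Groupoid o ℓ) {a} → Subgroup G a → Subgroup (op G) a
toOp G H = record
  { carrier = carrier ; has-e = has-e ; has-· = λ p q → has-· q p ; has-inv = has-inv }
  where open SubgroupOf H

perp : ∀ {o ℓ q} (G : Groupoid o ℓ) → KitFamily G q → KitFamily (op G) (suc ℓ ⊔ q)
perp G A a K = ∀ (H : Subgroup G a) → H ∈ A a →
  Orthogonal (op G) (toOp G H) K

-- Equality of the families of two kits (A and A^⊥⊥ live on G and G^op^op,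
-- which have definitionally the same objects, morphisms and subgroups).
KitEq : ∀ {o ℓ q r} (G : Groupoid o ℓ) → KitFamily G q → KitFamily (op (op G)) r →
      Set (o ⊔ suc ℓ ⊔ q ⊔ r)
KitEq G A B = ∀ (a : Groupoid.Obj G) (H : Subgroup G a) → H ∈ A a ⇔ H ∈ B a

-- A ⊆ A⊥⊥ holds for every kit, and more generally every subgroup H ⊆ ⋃A(a) lies in A⊥⊥,
-- because a member of A⊥ meets each member of A, hence ⋃A(a), trivially.  The rest is
-- about cyclic subgroups ⟨α⟩.  If α satisfies the premise of saturation then ⟨α⟩ ∈ A⊥⊥:
-- a nontrivial αᵈ in some K ∈ A⊥ would have a nontrivial multiple αᵈᵐ ∈ K ∩ ⋃A(a).
-- Conversely, if no nontrivial power of γ lies in ⋃A(a) then ⟨γ⟩ ∈ A⊥.  So A = A⊥⊥ yields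
-- (1) and, via ⟨α⟩, saturation; and given (1) and saturation, each h in some H ∈ A⊥⊥
-- lies in ⋃A(a), since a power hⁿ violating the premise spans a ⟨hⁿ⟩ ∈ A⊥ meeting H in hⁿ,
-- forcing hⁿ = id.  Only this last step is classical.
module Submission where

open import Defs
open import Level using (_⊔_) renaming (suc to lsuc)
open import Function.Bundles using (_⇔_; mk⇔; Equivalence)
open import Axiom.ExcludedMiddle using (ExcludedMiddle)
open import Axiom.DoubleNegationElimination using (DoubleNegationElimination; em⇒dne)

open import Algebra.Bundles using (Group)
import Algebra.Properties.Group as GroupProperties
open import Data.Empty using (⊥-elim)
open import Data.Nat using (zero; suc; _+_; _*_)
open import Data.Nat.Properties using (*-zeroʳ; *-suc)
open import Data.Product using (_×_; _,_; ∃-syntax)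
open import Data.Sum using (_⊎_; inj₁; inj₂)
open import Relation.Binary.PropositionalEquality
open import Relation.Nullary using (¬_; yes; no)
open import Relation.Unary using (Pred; _∈_)

module Endomorphisms {o ℓ} (G : Groupoid o ℓ) where
  open Groupoid G
  open ≡-Reasoning

  End : Obj → Group ℓ ℓ
  End a = record
    { Carrier = Hom a a
    ; _≈_     = _≡_
    ; _∙_     = _∘_
    ; ε       = id
    ; _⁻¹     = _⁻¹
    ; isGroup = record
      { isMonoid = record
        { isSemigroup = record
          { isMagma = record { isEquivalence = isEquivalence ; ∙-cong = cong₂ _∘_ }
          ; assoc   = assoc
          }
        ; identity = identityˡ , identityʳ
        }
      ; inverse = inverseˡ , inverseʳ
      ; ⁻¹-cong = cong _⁻¹
      }
    }

  private
    module EndProperties {a : Obj} = GroupProperties (End a)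
  open EndProperties

  fromOp : ∀ {a} → Subgroup (op G) a → Subgroup G a
  fromOp K = record
    { carrier = carrier ; has-e = has-e ; has-· = λ p q → has-· q p ; has-inv = has-inv }
    where open SubgroupOf K

  pow-sucʳ : ∀ {a} (α : Hom a a) n → pow G α (suc n) ≡ pow G α n ∘ α
  pow-sucʳ α zero    = trans (identityʳ α) (sym (identityˡ α))
  pow-sucʳ α (suc n) = trans (cong (α ∘_) (pow-sucʳ α n)) (sym (assoc _ _ _))

  pow-+ : ∀ {a} (α : Hom a a) m n → pow G α (m + n) ≡ pow G α m ∘ pow G α n
  pow-+ α zero    n = sym (identityˡ _)
  pow-+ α (suc m) n = trans (cong (α ∘_) (pow-+ α m n)) (sym (assoc _ _ _))

  pow-* : ∀ {a} (α : Hom a a) m n → pow G α (m * n) ≡ pow G (pow G α m) n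
  pow-* α m zero    rewrite *-zeroʳ m = refl
  pow-* α m (suc n) rewrite *-suc m n =
    trans (pow-+ α m (m * n)) (cong (pow G α m ∘_) (pow-* α m n))

  pow-closed : ∀ {a} (H : Subgroup G a) {α} → _∈ₛ_ G α H → ∀ n → _∈ₛ_ G (pow G α n) H
  pow-closed H α∈H zero    = SubgroupOf.has-e H
  pow-closed H α∈H (suc n) = SubgroupOf.has-· H α∈H (pow-closed H α∈H n)

  SignedPowerOf : ∀ {a} → Hom a a → Pred (Hom a a) ℓ
  SignedPowerOf α g = ∃[ d ] (g ≡ pow G α d ⊎ g ≡ pow G α d ⁻¹)

  pow∘pow⁻¹-signed : ∀ {a} (α : Hom a a) d e → SignedPowerOf α (pow G α d ∘ pow G α e ⁻¹)
  pow∘pow⁻¹-signed α zero    e       = e , inj₂ (identityˡ _)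
  pow∘pow⁻¹-signed α (suc d) zero    =
    suc d , inj₁ (trans (cong (pow G α (suc d) ∘_) ε⁻¹≈ε) (identityʳ _))
  pow∘pow⁻¹-signed α (suc d) (suc e) =
    subst (SignedPowerOf α) (sym cancel) (pow∘pow⁻¹-signed α d e)
    where
    x = pow G α d
    y = pow G α e
    cancel : pow G α (suc d) ∘ pow G α (suc e) ⁻¹ ≡ x ∘ y ⁻¹
    cancel = begin
      pow G α (suc d) ∘ pow G α (suc e) ⁻¹
        ≡⟨ cong₂ (λ u v → u ∘ v ⁻¹) (pow-sucʳ α d) (pow-sucʳ α e) ⟩
      (x ∘ α) ∘ (y ∘ α) ⁻¹     ≡⟨ cong ((x ∘ α) ∘_) (⁻¹-anti-homo-∙ y α) ⟩
      (x ∘ α) ∘ (α ⁻¹ ∘ y ⁻¹)  ≡⟨ sym (assoc _ _ _) ⟩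
      ((x ∘ α) ∘ α ⁻¹) ∘ y ⁻¹  ≡⟨ cong (_∘ y ⁻¹) (//-rightDividesʳ α x) ⟩
      x ∘ y ⁻¹                 ∎

  pow⁻¹∘pow-signed : ∀ {a} (α : Hom a a) d e → SignedPowerOf α (pow G α d ⁻¹ ∘ pow G α e)
  pow⁻¹∘pow-signed α zero    e       =
    e , inj₁ (trans (cong (_∘ pow G α e) ε⁻¹≈ε) (identityˡ _))
  pow⁻¹∘pow-signed α (suc d) zero    = suc d , inj₂ (identityʳ _)
  pow⁻¹∘pow-signed α (suc d) (suc e) =
    subst (SignedPowerOf α) (sym cancel) (pow⁻¹∘pow-signed α d e)
    where
    x = pow G α d
    y = pow G α e
    cancel : (α ∘ x) ⁻¹ ∘ (α ∘ y) ≡ x ⁻¹ ∘ y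
    cancel = begin
      (α ∘ x) ⁻¹ ∘ (α ∘ y)      ≡⟨ cong (_∘ (α ∘ y)) (⁻¹-anti-homo-∙ α x) ⟩
      (x ⁻¹ ∘ α ⁻¹) ∘ (α ∘ y)   ≡⟨ assoc _ _ _ ⟩
      x ⁻¹ ∘ (α ⁻¹ ∘ (α ∘ y))   ≡⟨ cong (x ⁻¹ ∘_) (\\-leftDividesʳ α y) ⟩
      x ⁻¹ ∘ y                  ∎

  ⟨_⟩ : ∀ {a} → Hom a a → Subgroup G a
  ⟨ α ⟩ = record
    { carrier = SignedPowerOf α
    ; has-e   = 0 , inj₁ refl
    ; has-·   = ∘-closed
    ; has-inv = ⁻¹-closed
    }
    where
    ∘-closed : ∀ {g h} → SignedPowerOf α g → SignedPowerOf α h → SignedPowerOf α (g ∘ h)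
    ∘-closed (d , inj₁ refl) (e , inj₁ refl) = d + e , inj₁ (sym (pow-+ α d e))
    ∘-closed (d , inj₁ refl) (e , inj₂ refl) = pow∘pow⁻¹-signed α d e
    ∘-closed (d , inj₂ refl) (e , inj₁ refl) = pow⁻¹∘pow-signed α d e
    ∘-closed (d , inj₂ refl) (e , inj₂ refl) =
      e + d , inj₂ (trans (sym (⁻¹-anti-homo-∙ _ _)) (cong _⁻¹ (sym (pow-+ α e d))))
    ⁻¹-closed : ∀ {g} → SignedPowerOf α g → SignedPowerOf α (g ⁻¹)
    ⁻¹-closed (d , inj₁ refl) = d , inj₂ refl
    ⁻¹-closed (d , inj₂ refl) = d , inj₁ (⁻¹-involutive _)

  α∈⟨α⟩ : ∀ {a} (α : Hom a a) → _∈ₛ_ G α ⟨ α ⟩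
  α∈⟨α⟩ α = 1 , inj₁ (sym (identityʳ α))

  ⟨⟩-orthogonal : ∀ {a} (H : Subgroup G a) {α} →
                  (∀ d → _∈ₛ_ G (pow G α d) H → pow G α d ≡ id) → Orthogonal G H ⟨ α ⟩
  ⟨⟩-orthogonal H trivial g g∈H (d , inj₁ refl) = trivial d g∈H
  ⟨⟩-orthogonal H trivial g g∈H (d , inj₂ refl) = begin
    pow G _ d ⁻¹ ≡⟨ cong _⁻¹ (trivial d (subst (_∈ carrier) (⁻¹-involutive _) (has-inv g∈H))) ⟩
    id ⁻¹        ≡⟨ ε⁻¹≈ε ⟩
    id           ∎
    where open SubgroupOf H

module KitClosure {o ℓ q} (G : Groupoid o ℓ) (A : KitFamily G q) where
  open Groupoid G
  open Endomorphisms G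

  ∈⇒⊆⋃ : ∀ {a} {H : Subgroup G a} → H ∈ A a → ∀ g → _∈ₛ_ G g H → g ∈ ⋃ G A a
  ∈⇒⊆⋃ {H = H} H∈A g g∈H = H , H∈A , g∈H

  ⊆⋃⇒∈perp² : ∀ {a} (H : Subgroup G a) → (∀ g → _∈ₛ_ G g H → g ∈ ⋃ G A a) →
              H ∈ perp (op G) (perp G A) a
  ⊆⋃⇒∈perp² H H⊆⋃ K K∈A⊥ g g∈K g∈H with H⊆⋃ g g∈H
  ... | H′ , H′∈A , g∈H′ = K∈A⊥ H′ H′∈A g g∈H′ g∈K

  ⟨⟩∈perp : ∀ {a} {γ : Hom a a} → (∀ d → pow G γ d ∈ ⋃ G A a → pow G γ d ≡ id) →
            toOp G ⟨ γ ⟩ ∈ perp G A a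
  ⟨⟩∈perp trivial H H∈A = ⟨⟩-orthogonal H λ d γᵈ∈H → trivial d (H , H∈A , γᵈ∈H)

  SaturationPremise : ∀ {a} → Hom a a → Set (lsuc ℓ ⊔ q)
  SaturationPremise {a} α =
    ∀ n → pow G α n ≡ id ⊎ ∃[ m ] (¬ pow G α (n * m) ≡ id × pow G α (n * m) ∈ ⋃ G A a)

  ⟨⟩∈perp² : ∀ {a} {α : Hom a a} → SaturationPremise α →
             ⟨ α ⟩ ∈ perp (op G) (perp G A) a
  ⟨⟩∈perp² {α = α} reach K K∈A⊥ = ⟨⟩-orthogonal (fromOp K) trivial
    where
    trivial : ∀ d → _∈ₛ_ G (pow G α d) (fromOp K) → pow G α d ≡ id
    trivial d αᵈ∈K with reach d
    ... | inj₁ αᵈ≡id = αᵈ≡id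
    ... | inj₂ (m , αᵈᵐ≢id , H , H∈A , αᵈᵐ∈H) =
      ⊥-elim (αᵈᵐ≢id (K∈A⊥ H H∈A _ αᵈᵐ∈H
        (subst (_∈ SubgroupOf.carrier K) (sym (pow-* α d m))
               (pow-closed (fromOp K) αᵈ∈K m))))

  ∈perp²⇒saturation-premise : ExcludedMiddle (lsuc ℓ ⊔ q) → DoubleNegationElimination ℓ →
    ∀ {a} (H : Subgroup G a) → H ∈ perp (op G) (perp G A) a →
    ∀ {h} → _∈ₛ_ G h H → SaturationPremise h
  ∈perp²⇒saturation-premise em dne {a} H H∈A⊥⊥ {h} h∈H n with em
  ... | yes reach = inj₂ reach
  ... | no ¬reach =
    inj₁ (H∈A⊥⊥ (toOp G ⟨ hⁿ ⟩) (⟨⟩∈perp trivial) hⁿ (α∈⟨α⟩ hⁿ) (pow-closed H h∈H n))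
    where
    hⁿ = pow G h n
    trivial : ∀ d → pow G hⁿ d ∈ ⋃ G A a → pow G hⁿ d ≡ id
    trivial d hⁿᵈ∈⋃ rewrite sym (pow-* h n d) =
      dne λ hⁿᵈ≢id → ¬reach (d , hⁿᵈ≢id , hⁿᵈ∈⋃)

lemma4p9 : (lem : ∀ {l} → ExcludedMiddle l) →
           ∀ {o ℓ q} (G : Groupoid o ℓ) (A : Kit G q) →
           KitEq G (Kit.family A) (perp (op G) (perp G (Kit.family A)))
             ⇔ (Condition1 G (Kit.family A) × Saturated G (Kit.family A))
lemma4p9 lem G A = mk⇔
  (λ A≡A⊥⊥ →
     (λ a H → mk⇔ (∈⇒⊆⋃ {H = H}) λ H⊆⋃ → from (A≡A⊥⊥ a H) (⊆⋃⇒∈perp² H H⊆⋃))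
   , (λ a α premise → ⟨ α ⟩ , from (A≡A⊥⊥ a ⟨ α ⟩) (⟨⟩∈perp² premise) , α∈⟨α⟩ α))
  (λ (condition1 , saturated) a H →
     mk⇔ (λ H∈A → ⊆⋃⇒∈perp² H (∈⇒⊆⋃ H∈A))
         (λ H∈A⊥⊥ → from (condition1 a H) λ h h∈H →
            saturated a h (∈perp²⇒saturation-premise lem (em⇒dne lem) H H∈A⊥⊥ h∈H)))
  where
  open Endomorphisms G using (⟨_⟩; α∈⟨α⟩)
  open KitClosure G (Kit.family A)
  open Equivalence using (from)
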